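{- Let $\mathtt{T}=(\Sigma,Ax)$ be a theory. Then: (1) if $\Upsilon\vdash_{\mathtt{T}}\pi\curlywedge t$ then $\Upsilon\vDash^s_{\mathtt{T}}\pi\curlywedge t$; (2) if $\Upsilon\vdash_{\mathtt{T}}t=u$ then $\Upsilon\vDash^s_{\mathtt{T}}t=u$.
   Context: Syntax. Atoms $\mathbb{A}$ and variables $\mathbb{V}$ are disjoint countably infinite sets; $\Sigma$ is a finite set of term-formers with arities. $\mathrm{Perm}(\mathbb{A})$ is the group of bijections of $\mathbb{A}$ with finite $\mathrm{dom}(\pi)=\{a\mid\pi(a)\ne a\}$; $(a\ b)$ is a swapping; $\pi^{\rho}=\rho\circ\pi\circ\rho^{ -1}$. Nominal terms: $t::=a\mid\pi\cdot X\mid[a]t\mid\mathsf{f}(t_1,\ldots,t_n)$ ($X$ abbreviates $\mathrm{id}\cdot X$). Action on terms: $\pi\cdot a=\pi(a)$, $\pi\cdot(\pi'\cdot X)=(\pi\circ\pi')\cdot X$, $\pi\cdot[a]t=[\pi(a)](\pi\cdot t)$, $\pi\cdot\mathsf{f}(\vec t)=\mathsf{f}(\pi\cdot\vec t)$. $\mathrm{var}(t)$ is the set of variables in $t$. Substitutions $\sigma$ map finitely many variables to terms and extend homomorphically, with $(\pi\cdot X)\sigma=\pi\cdot(X\sigma)$. A fixed-point context $\Upsilon$ is a finite set of constraints $\gamma\curlywedge X$; $\mathrm{perm}(\Upsilon|_X)=\{\gamma\mid\gamma\curlywedge X\in\Upsilon\}$, $\mathrm{dom}(\mathrm{perm}(\Upsilon|_X))=\bigcup_{\gamma\in\mathrm{perm}(\Upsilon|_X)}\mathrm{dom}(\gamma)$.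 Judgements: $\Upsilon\vdash\pi\curlywedge t$ and $\Upsilon\vdash t=u$. A theory $\mathtt{T}=(\Sigma,Ax)$ has a set $Ax$ of axioms $\Upsilon'\vdash t=u$. Rules ("fresh" atoms are pairwise distinct and occur nowhere in the conclusion): $(\curlywedge\mathbf a)$ $\Upsilon\vdash\pi\curlywedge a$ if $\pi(a)=a$; $(\curlywedge\mathsf f)$ from $\Upsilon\vdash\pi\curlywedge t_i$ ($1\le i\le n$) infer $\Upsilon\vdash\pi\curlywedge\mathsf f(t_1,\ldots,t_n)$; $(\curlywedge\mathbf{var})$ $\Upsilon\vdash\pi\curlywedge\pi'\cdot X$ if $\mathrm{dom}(\pi^{\pi'^{ -1}})\subseteq\mathrm{dom}(\mathrm{perm}(\Upsilon|_X))$; $(\curlywedge\mathbf{abs})$ from $\Upsilon\cup\{(c_1\ c_2)\curlywedge Y\mid Y\in\mathrm{var}(t)\}\vdash\pi\curlywedge(a\ c_1)\cdot t$ infer $\Upsilon\vdash\pi\curlywedge[a]t$ ($c_1,c_2$ fresh); $(\mathbf{refl})$, $(\mathbf{symm})$, $(\mathbf{tran})$ for $=$; $(\mathbf{ax}_{\Upsilon'\vdash t=u})$ for $(\Upsilon'\vdash t=u)\in Ax$, any permutation $\pi$ and substitution $\sigma$: from $\Upsilon\vdash\pi'^{\pi}\curlywedge\pi\cdot(X\sigma)$ for every $\pi'\curlywedge X\in\Upsilon'$ infer $\Upsilon\vdash\pi\cdot(t\sigma)=\pi\cdot(u\sigma)$; $(\mathbf{cong}[])$ from $\Upsilon\vdash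 t=u$ infer $\Upsilon\vdash[a]t=[a]u$; $(\mathbf{cong}\mathsf f)$ from $\Upsilon\vdash t=u$ infer $\Upsilon\vdash\mathsf f(\ldots,t,\ldots)=\mathsf f(\ldots,u,\ldots)$; $(\mathbf{fr})$ from $\Upsilon\cup\{\pi\curlywedge X\}\vdash t=u$ with $\mathrm{dom}(\pi)\subseteq\mathrm{dom}(\mathrm{perm}(\Upsilon|_X))$ infer $\Upsilon\vdash t=u$; $(\mathbf{perm})$ from $\Upsilon\cup\{(c_1\ c_2)\curlywedge Y\mid Y\in\mathrm{var}(t)\}\vdash(a\ c_1)\curlywedge t$ and $\Upsilon\cup\{(d_1\ d_2)\curlywedge Y\mid Y\in\mathrm{var}(t)\}\vdash(b\ d_1)\curlywedge t$ infer $\Upsilon\vdash(a\ b)\cdot t=t$ ($c_1,c_2,d_1,d_2$ fresh). $\Upsilon\vdash_{\mathtt T}J$ means $J$ is derivable from hypotheses in $\Upsilon$, using only axioms of $Ax$ and terms over $\Sigma$. Semantics. A nominal set is a $\mathrm{Perm}(\mathbb{A})$-set each of whose elements has a finite support; it is strong if each element $x$ has a finite $B$ with: $\pi$ fixes $B$ pointwise iff $\pi\cdot x=x$. A (strong) nominal $\Sigma$-algebra: a (strong) nominal set $\mathsf A$, equivariant $\mathtt{atom}:\mathbb{A}\to|\mathsf A|$, equivariant $\mathtt{abs}:\mathbb{A}\times|\mathsf A|\to|\mathsf A|$ with $\{c\mid(a\ c)\cdot\mathtt{abs}(a,x)\ne\mathtt{abs}(a,x)\}$ finite for all $a,x$,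 and equivariant $f:|\mathsf A|^n\to|\mathsf A|$ for each $\mathsf f:n$. For a valuation $\varsigma:\mathbb{V}\to|\mathsf A|$: $[\![a]\!]_\varsigma=\mathtt{atom}(a)$, $[\![\pi\cdot X]\!]_\varsigma=\pi\cdot\varsigma(X)$, $[\![\mathsf f(\vec t)]\!]_\varsigma=f([\![\vec t]\!]_\varsigma)$, $[\![[a]t]\!]_\varsigma=\mathtt{abs}(a,[\![t]\!]_\varsigma)$. $[\![\Upsilon]\!]_\varsigma$ is valid iff $\gamma\cdot\varsigma(X)=\varsigma(X)$ for all $\gamma\curlywedge X\in\Upsilon$; $[\![\Upsilon\vdash\pi\curlywedge t]\!]_\varsigma$ valid iff ($[\![\Upsilon]\!]_\varsigma$ valid implies $\pi\cdot[\![t]\!]_\varsigma=[\![t]\!]_\varsigma$); $[\![\Upsilon\vdash t=u]\!]_\varsigma$ valid iff ($[\![\Upsilon]\!]_\varsigma$ valid implies $[\![t]\!]_\varsigma=[\![u]\!]_\varsigma$). A strong model of $\mathtt T$ is a strong nominal $\Sigma$-algebra in which every axiom of $Ax$ is valid for every valuation. $\Upsilon\vDash^s_{\mathtt T}J$ means $[\![\Upsilon\vdash J]\!]_\varsigma$ is valid for every strong model of $\mathtt T$ and every valuation $\varsigma$. -}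

module Defs where

open import Level using (Level; _⊔_) renaming (suc to lsuc; zero to lzero)
open import Data.Nat using (ℕ; _≟_)
open import Data.Fin using (Fin)
open import Data.Bool using (true; false; if_then_else_)
open import Data.List using (List; []; _∷_; _++_; map)
open import Data.List.Membership.Propositional using (_∈_)
open import Data.List.Relation.Unary.Any using (here; there)
open import Data.List.Membership.Propositional.Properties using (∈-++⁺ˡ; ∈-++⁺ʳ)
open import Data.Vec as V using (Vec)
open import Data.Product using (Σ; ∃; _×_; _,_; proj₁; proj₂)
open import Function.Bundles using (_⇔_)
open import Relation.Nullary using (¬_; yes; no)
open import Relation.Binary.PropositionalEquality
  using (_≡_; _≢_; refl; sym; trans; cong)

-- Atoms and variables (two disjoint countably infinite sets, kept as
-- distinct syntactic categories)

Atom : Set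
Atom = ℕ

Var : Set
Var = ℕ

record Perm : Set where
  field
    fun    : Atom → Atom
    inv    : Atom → Atom
    inv-l  : ∀ a → inv (fun a) ≡ a
    inv-r  : ∀ a → fun (inv a) ≡ a
    supp   : List Atom
    finite : ∀ a → fun a ≢ a → a ∈ supp
open Perm public

_∈dom_ : Atom → Perm → Set
a ∈dom π = fun π a ≢ a

_≗P_ : Perm → Perm → Set
π ≗P ρ = ∀ a → fun π a ≡ fun ρ a

idP : Perm
idP = record { fun = λ a → a ; inv = λ a → a ; inv-l = λ _ → refl
             ; inv-r = λ _ → refl ; supp = [] ; finite = λ a p → ⊥-e (p refl) }
  where
  open import Data.Empty using (⊥-elim)
  ⊥-e = ⊥-elim

_∘P_ : Perm → Perm → Perm
π ∘P ρ = record
  { fun = λ a → fun π (fun ρ a)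
  ; inv = λ a → inv ρ (inv π a)
  ; inv-l = λ a → trans (cong (inv ρ) (inv-l π (fun ρ a))) (inv-l ρ a)
  ; inv-r = λ a → trans (cong (fun π) (inv-r ρ (inv π a))) (inv-r π a)
  ; supp = supp π ++ supp ρ
  ; finite = fin
  }
  where
  fin : ∀ a → fun π (fun ρ a) ≢ a → a ∈ (supp π ++ supp ρ)
  fin a ne with fun ρ a ≟ a
  ... | no ρa≢a = ∈-++⁺ʳ (supp π) (finite ρ a ρa≢a)
  ... | yes ρa≡a = ∈-++⁺ˡ (finite π a (λ e → ne (trans (cong (fun π) ρa≡a) e)))

_⁻¹P : Perm → Perm
π ⁻¹P = record
  { fun = inv π ; inv = fun π ; inv-l = inv-r π ; inv-r = inv-l π
  ; supp = supp π
  ; finite = λ a ne → finite π a (λ e → ne (trans (cong (inv π) (sym e)) (inv-l π a)))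
  }

_^_ : Perm → Perm → Perm
π ^ ρ = ρ ∘P (π ∘P (ρ ⁻¹P))

sw : Atom → Atom → Atom → Atom
sw a b c with c ≟ a
... | yes _ = b
... | no _ with c ≟ b
... | yes _ = a
... | no _ = c

private
  sw-a : ∀ a b → sw a b a ≡ b
  sw-a a b with a ≟ a
  ... | yes _ = refl
  ... | no n = ⊥-elim (n refl)
    where open import Data.Empty using (⊥-elim)

  sw-b : ∀ a b → sw a b b ≡ a
  sw-b a b with b ≟ a
  ... | yes e = e
  ... | no _ with b ≟ b
  ... | yes _ = refl
  ... | no n = ⊥-elim (n refl)
    where open import Data.Empty using (⊥-elim)

  sw-o : ∀ a b c → c ≢ a → c ≢ b → sw a b c ≡ c
  sw-o a b c na nb with c ≟ a
  ... | yes e = ⊥-elim (na e)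
    where open import Data.Empty using (⊥-elim)
  ... | no _ with c ≟ b
  ... | yes e = ⊥-elim (nb e)
    where open import Data.Empty using (⊥-elim)
  ... | no _ = refl

  sw-inv : ∀ a b c → sw a b (sw a b c) ≡ c
  sw-inv a b c with c ≟ a
  sw-inv a b c | yes refl = sw-b a b
  sw-inv a b c | no na with c ≟ b
  sw-inv a b c | no na | yes refl = sw-a a b
  sw-inv a b c | no na | no nb = sw-o a b c na nb

  sw-fin : ∀ a b c → sw a b c ≢ c → c ∈ (a ∷ b ∷ [])
  sw-fin a b c ne with c ≟ a
  ... | yes e = here e
  ... | no na with c ≟ b
  ... | yes e = there (here e)
  ... | no nb = ⊥-elim (ne refl)
    where open import Data.Empty using (⊥-elim)

⟨_⇄_⟩ : Atom → Atom → Perm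
⟨ a ⇄ b ⟩ = record
  { fun = sw a b ; inv = sw a b ; inv-l = sw-inv a b ; inv-r = sw-inv a b
  ; supp = a ∷ b ∷ [] ; finite = sw-fin a b }

record Signature : Set where
  field
    size  : ℕ
    arity : Fin size → ℕ
open Signature public

module _ (S : Signature) where

  data Term : Set where
    atm : Atom → Term
    mv  : Perm → Var → Term
    lam : Atom → Term → Term
    app : (f : Fin (size S)) → Vec Term (arity S f) → Term

module _ {S : Signature} where

  ‵ : Var → Term S
  ‵ X = mv idP X

  mutual
    _·_ : Perm → Term S → Term S
    π · atm a     = atm (fun π a)
    π · mv ρ X    = mv (π ∘P ρ) X
    π · lam a t   = lam (fun π a) (π · t)
    π · app f ts  = app f (π ·s ts)

    _·s_ : ∀ {n} → Perm → Vec (Term S) n → Vec (Term S) n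
    π ·s V.[]       = V.[]
    π ·s (t V.∷ ts) = (π · t) V.∷ (π ·s ts)

  mutual
    vars : Term S → List Var
    vars (atm a)    = []
    vars (mv π X)   = X ∷ []
    vars (lam a t)  = vars t
    vars (app f ts) = varss ts

    varss : ∀ {n} → Vec (Term S) n → List Var
    varss V.[]       = []
    varss (t V.∷ ts) = vars t ++ varss ts

  mutual
    data _occ_ (c : Atom) : Term S → Set where
      occ-atm : c occ atm c
      occ-mv  : ∀ {π X} → c ∈dom π → c occ mv π X
      occ-lam : ∀ {t} → c occ lam c t
      occ-in  : ∀ {a t} → c occ t → c occ lam a t
      occ-app : ∀ {f ts} → c occs ts → c occ app f ts

    data _occs_ (c : Atom) : ∀ {n} → Vec (Term S) n → Set where
      occ-hd : ∀ {n t} {ts : Vec (Term S) n} → c occ t → c occs (t V.∷ ts)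
      occ-tl : ∀ {n t} {ts : Vec (Term S) n} → c occs ts → c occs (t V.∷ ts)

  -- syntactic identity of terms, with permutations compared as functions
  -- (permutations are bijections, so two terms are the same term iff
  -- they agree up to extensional equality of their permutations)
  mutual
    data _≋_ : Term S → Term S → Set where
      ≋-atm : ∀ {a} → atm a ≋ atm a
      ≋-mv  : ∀ {π ρ X} → π ≗P ρ → mv π X ≋ mv ρ X
      ≋-lam : ∀ {a t u} → t ≋ u → lam a t ≋ lam a u
      ≋-app : ∀ {f ts us} → ts ≋s us → app f ts ≋ app f us

    data _≋s_ : ∀ {n} → Vec (Term S) n → Vec (Term S) n → Set where
      ≋-[] : V.[] ≋s V.[]
      ≋-∷  : ∀ {n t u} {ts us : Vec (Term S) n} → t ≋ u → ts ≋s us → (t V.∷ ts) ≋s (u V.∷ us)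

  Subst : Set
  Subst = List (Var × Term S)

  lookupσ : Subst → Var → Term S
  lookupσ []             X = ‵ X
  lookupσ ((Y , t) ∷ σ) X with X ≟ Y
  ... | yes _ = t
  ... | no _  = lookupσ σ X

  mutual
    _[_] : Term S → Subst → Term S
    atm a [ σ ]    = atm a
    mv π X [ σ ]   = π · lookupσ σ X
    lam a t [ σ ]  = lam a (t [ σ ])
    app f ts [ σ ] = app f (ts [ σ ]s)

    _[_]s : ∀ {n} → Vec (Term S) n → Subst → Vec (Term S) n
    V.[] [ σ ]s       = V.[]
    (t V.∷ ts) [ σ ]s = (t [ σ ]) V.∷ (ts [ σ ]s)

-- Fixed-point contexts: finite sets of constraints γ ⅄ X

Ctx : Set
Ctx = List (Perm × Var)

_∈domCtx_∣_ : Atom → Ctx → Var → Set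
a ∈domCtx Υ ∣ X = ∃ λ γ → ((γ , X) ∈ Υ) × (a ∈dom γ)

_⊆domCtx_∣_ : Perm → Ctx → Var → Set
π ⊆domCtx Υ ∣ X = ∀ a → a ∈dom π → a ∈domCtx Υ ∣ X

_occΥ_ : Atom → Ctx → Set
c occΥ Υ = ∃ λ γ → ∃ λ X → ((γ , X) ∈ Υ) × (c ∈dom γ)

swCtx : ∀ {S} → Atom → Atom → Term S → Ctx
swCtx c₁ c₂ t = map (λ Y → (⟨ c₁ ⇄ c₂ ⟩ , Y)) (vars t)

FreshFor : ∀ {S} → Atom → Ctx → List Perm → List (Term S) → Set
FreshFor c Υ πs ts =
  ¬ (c occΥ Υ) × (∀ {π} → π ∈ πs → ¬ (c ∈dom π)) × (∀ {t} → t ∈ ts → ¬ (c occ t))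

data _⊢_⅄_ {S : Signature} (Υ : Ctx) : Perm → Term S → Set where
  ⅄a   : ∀ {π a} → fun π a ≡ a → Υ ⊢ π ⅄ atm a
  ⅄f   : ∀ {π f} {ts : Vec (Term S) (arity S f)} →
         (∀ i → Υ ⊢ π ⅄ V.lookup ts i) → Υ ⊢ π ⅄ app f ts
  ⅄var : ∀ {π π' X} → (π ^ (π' ⁻¹P)) ⊆domCtx Υ ∣ X → Υ ⊢ π ⅄ mv π' X
  ⅄abs : ∀ {π a t} (c₁ c₂ : Atom) →
         c₁ ≢ c₂ →
         FreshFor c₁ Υ (π ∷ []) (lam a t ∷ []) →
         FreshFor c₂ Υ (π ∷ []) (lam a t ∷ []) →
         (Υ ++ swCtx c₁ c₂ t) ⊢ π ⅄ (⟨ a ⇄ c₁ ⟩ · t) →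
         Υ ⊢ π ⅄ lam a t

record Axiom (S : Signature) : Set where
  constructor _⊩_≐_
  field
    actx : Ctx
    lhs  : Term S
    rhs  : Term S
open Axiom public

record Theory : Set₁ where
  field
    sig : Signature
    Ax  : Axiom sig → Set        -- a (possibly infinite) set of axioms
open Theory public

data _⊢[_]_≐_ (Υ : Ctx) (T : Theory) : Term (sig T) → Term (sig T) → Set where
  refl≐ : ∀ {t u} → t ≋ u → Υ ⊢[ T ] t ≐ u
  symm  : ∀ {t u} → Υ ⊢[ T ] t ≐ u → Υ ⊢[ T ] u ≐ t
  tran  : ∀ {t u v} → Υ ⊢[ T ] t ≐ u → Υ ⊢[ T ] u ≐ v → Υ ⊢[ T ] t ≐ v
  ax    : ∀ {Υ' t u} → Ax T (Υ' ⊩ t ≐ u) → (π : Perm) (σ : Subst) →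
          (∀ {π' X} → (π' , X) ∈ Υ' → Υ ⊢ (π' ^ π) ⅄ (π · (‵ X [ σ ]))) →
          Υ ⊢[ T ] (π · (t [ σ ])) ≐ (π · (u [ σ ]))
  cong[] : ∀ {a t u} → Υ ⊢[ T ] t ≐ u → Υ ⊢[ T ] lam a t ≐ lam a u
  congf  : ∀ {f} (ts : Vec (Term (sig T)) (arity (sig T) f)) (i : Fin (arity (sig T) f)) {t u} →
           Υ ⊢[ T ] t ≐ u → Υ ⊢[ T ] app f (ts V.[ i ]≔ t) ≐ app f (ts V.[ i ]≔ u)
  fr    : ∀ {π X t u} → π ⊆domCtx Υ ∣ X →
          ((π , X) ∷ Υ) ⊢[ T ] t ≐ u → Υ ⊢[ T ] t ≐ u
  perm  : ∀ {a b t} (c₁ c₂ d₁ d₂ : Atom) →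
          c₁ ≢ c₂ → c₁ ≢ d₁ → c₁ ≢ d₂ → c₂ ≢ d₁ → c₂ ≢ d₂ → d₁ ≢ d₂ →
          FreshFor c₁ Υ [] ((⟨ a ⇄ b ⟩ · t) ∷ t ∷ []) →
          FreshFor c₂ Υ [] ((⟨ a ⇄ b ⟩ · t) ∷ t ∷ []) →
          FreshFor d₁ Υ [] ((⟨ a ⇄ b ⟩ · t) ∷ t ∷ []) →
          FreshFor d₂ Υ [] ((⟨ a ⇄ b ⟩ · t) ∷ t ∷ []) →
          (Υ ++ swCtx c₁ c₂ t) ⊢ ⟨ a ⇄ c₁ ⟩ ⅄ t →
          (Υ ++ swCtx d₁ d₂ t) ⊢ ⟨ b ⇄ d₁ ⟩ ⅄ t →
          Υ ⊢[ T ] (⟨ a ⇄ b ⟩ · t) ≐ t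

record NominalSet (ℓ : Level) : Set (lsuc ℓ) where
  field
    Carrier : Set ℓ
    act     : Perm → Carrier → Carrier
    act-id  : ∀ x → act idP x ≡ x
    act-∘   : ∀ π ρ x → act π (act ρ x) ≡ act (π ∘P ρ) x
    act-ext : ∀ π ρ → π ≗P ρ → ∀ x → act π x ≡ act ρ x
    supported : ∀ x → ∃ λ (B : List Atom) →
                ∀ π → (∀ a → a ∈ B → fun π a ≡ a) → act π x ≡ x

  IsStrong : Set ℓ
  IsStrong = ∀ x → ∃ λ (B : List Atom) →
             ∀ π → ((∀ a → a ∈ B → fun π a ≡ a) ⇔ (act π x ≡ x))

record StrongAlgebra (ℓ : Level) (S : Signature) : Set (lsuc ℓ) where
  field
    nom    : NominalSet ℓ
    strong : NominalSet.IsStrong nom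
  open NominalSet nom public
  field
    atomᴬ  : Atom → Carrier
    absᴬ   : Atom → Carrier → Carrier
    opᴬ    : (f : Fin (size S)) → Vec Carrier (arity S f) → Carrier
    atom-eqv : ∀ π a → atomᴬ (fun π a) ≡ act π (atomᴬ a)
    abs-eqv  : ∀ π a x → absᴬ (fun π a) (act π x) ≡ act π (absᴬ a x)
    abs-fin  : ∀ a x → ∃ λ (L : List Atom) →
               ∀ c → act ⟨ a ⇄ c ⟩ (absᴬ a x) ≢ absᴬ a x → c ∈ L
    op-eqv   : ∀ π f (xs : Vec Carrier (arity S f)) →
               opᴬ f (V.map (act π) xs) ≡ act π (opᴬ f xs)

module _ {ℓ : Level} {S : Signature} (A : StrongAlgebra ℓ S) where
  open StrongAlgebra A

  Valuation : Set ℓ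
  Valuation = Var → Carrier

  mutual
    ⟦_⟧ : Term S → Valuation → Carrier
    ⟦ atm a ⟧ ς    = atomᴬ a
    ⟦ mv π X ⟧ ς   = act π (ς X)
    ⟦ lam a t ⟧ ς  = absᴬ a (⟦ t ⟧ ς)
    ⟦ app f ts ⟧ ς = opᴬ f (⟦ ts ⟧s ς)

    ⟦_⟧s : ∀ {n} → Vec (Term S) n → Valuation → Vec Carrier n
    ⟦ V.[] ⟧s ς     = V.[]
    ⟦ t V.∷ ts ⟧s ς = ⟦ t ⟧ ς V.∷ ⟦ ts ⟧s ς

  ValidCtx : Ctx → Valuation → Set ℓ
  ValidCtx Υ ς = ∀ {γ X} → (γ , X) ∈ Υ → act γ (ς X) ≡ ς X

  ValidFresh : Ctx → Perm → Term S → Valuation → Set ℓ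
  ValidFresh Υ π t ς = ValidCtx Υ ς → act π (⟦ t ⟧ ς) ≡ ⟦ t ⟧ ς

  ValidEq : Ctx → Term S → Term S → Valuation → Set ℓ
  ValidEq Υ t u ς = ValidCtx Υ ς → ⟦ t ⟧ ς ≡ ⟦ u ⟧ ς

record StrongModel (ℓ : Level) (T : Theory) : Set (lsuc ℓ) where
  field
    alg   : StrongAlgebra ℓ (sig T)
    sound : ∀ {ax} → Ax T ax → ∀ ς → ValidEq alg (actx ax) (lhs ax) (rhs ax) ς
open StrongModel public

_⊨ˢ[_,_]_⅄_ : (Υ : Ctx) (T : Theory) (ℓ : Level) → Perm → Term (sig T) → Set (lsuc ℓ)
Υ ⊨ˢ[ T , ℓ ] π ⅄ t = (M : StrongModel ℓ T) (ς : Valuation (alg M)) → ValidFresh (alg M) Υ π t ς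

_⊨ˢ[_,_]_≐_ : (Υ : Ctx) (T : Theory) (ℓ : Level) → Term (sig T) → Term (sig T) → Set (lsuc ℓ)
Υ ⊨ˢ[ T , ℓ ] t ≐ u = (M : StrongModel ℓ T) (ς : Valuation (alg M)) → ValidEq (alg M) Υ t u ς

{-# OPTIONS --safe #-}
-- Soundness goes by induction on derivations; only the rules with freshness side
-- conditions, (⅄abs) and (perm), need an idea. Their premises hold under Υ extended
-- by (c₁ c₂) ⅄ Y for Y ∈ var(t). Instantiating a premise at the valuation τ ∘ ς,
-- where τ = (c₁ e₁)(c₂ e₂) and e₁, e₂ are fresh for everything in sight (including
-- the supports of the values ς Y), validates that extension, and equivariance of the
-- interpretation carries the conclusion back along τ, turning (a c₁) into (a e₁).
-- Strongness is used twice: π ⅄ X with dom π ⊆ dom(perm(Υ|X)) holds because the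
-- strong support of ς X avoids every atom moved by a stabiliser of ς X; and the
-- binder a lies outside the strong support of abs(a, x) (by the cofiniteness
-- condition on abs), so abs(a, x) = abs(e, (a e)·x) for fresh e.

module Submission where

open import Defs
open import Level using (Level)
open import Data.Product using (_×_; ∃; _,_; proj₁; proj₂)
open import Data.Nat using (suc; _≟_; s≤s)
open import Data.Nat.Properties using (<⇒≢)
open import Data.Fin as Fin using ()
open import Data.Empty using (⊥-elim)
open import Data.List using (List; []; _∷_; _++_; concatMap)
open import Data.List.Extrema.Nat using (max; xs≤max)
open import Data.List.Relation.Unary.All as All using (All; []; _∷_)
open import Data.List.Relation.Unary.All.Properties using (++⁻ˡ; ++⁻ʳ)
open import Data.List.Relation.Unary.Any using (here; there)
open import Data.List.Membership.Propositional using (_∈_; lose)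
open import Data.List.Membership.Propositional.Properties
  using (∈-++⁺ˡ; ∈-++⁺ʳ; ∈-++⁻; ∈-map⁻; ∈-concatMap⁺)
open import Data.Vec as V using (Vec)
open import Data.Sum using (inj₁; inj₂)
open import Function using (_∘_)
open import Function.Bundles using (Equivalence)
open import Relation.Nullary using (¬_; yes; no)
open import Relation.Nullary.Decidable using (decidable-stable)
open import Relation.Binary.PropositionalEquality
  using (_≡_; _≢_; refl; sym; trans; cong; cong₂; subst; ≢-sym; module ≡-Reasoning)
open ≡-Reasoning

fun-injective : ∀ π {x y} → fun π x ≡ fun π y → x ≡ y
fun-injective π {x} {y} eq = begin
  x                ≡⟨ inv-l π x ⟨
  inv π (fun π x)  ≡⟨ cong (inv π) eq ⟩
  inv π (fun π y)  ≡⟨ inv-l π y ⟩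
  y                ∎

supp-fresh-fixed : ∀ π {e} → All (_≢ e) (supp π) → fun π e ≡ e
supp-fresh-fixed π {e} e# =
  decidable-stable (fun π e ≟ e) (λ e∈domπ → All.lookup e# (finite π e e∈domπ) refl)

fun-comm : ∀ π τ → (∀ c → c ∈dom π → fun τ c ≡ c) → ∀ c → fun π (fun τ c) ≡ fun τ (fun π c)
fun-comm π τ τ-fixes c with fun π c ≟ c
... | no πc≢c = begin
  fun π (fun τ c)  ≡⟨ cong (fun π) (τ-fixes c πc≢c) ⟩
  fun π c          ≡⟨ τ-fixes (fun π c) (πc≢c ∘ fun-injective π) ⟨
  fun τ (fun π c)  ∎
... | yes πc≡c with fun π (fun τ c) ≟ fun τ c
...   | yes πτc≡τc = trans πτc≡τc (cong (fun τ) (sym πc≡c))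
...   | no πτc≢τc = ⊥-elim (πτc≢τc (begin
  fun π (fun τ c)  ≡⟨ cong (fun π) τc≡c ⟩
  fun π c          ≡⟨ πc≡c ⟩
  c                ≡⟨ τc≡c ⟨
  fun τ c          ∎))
  where
  τc≡c : fun τ c ≡ c
  τc≡c = fun-injective τ (τ-fixes (fun τ c) πτc≢τc)

sw-first : ∀ a b → sw a b a ≡ b
sw-first a b with a ≟ a
... | yes _ = refl
... | no a≢a = ⊥-elim (a≢a refl)

sw-second : ∀ a b → sw a b b ≡ a
sw-second a b with b ≟ a
... | yes b≡a = b≡a
... | no _ with b ≟ b
...   | yes _ = refl
...   | no b≢b = ⊥-elim (b≢b refl)

sw-other : ∀ {a b c} → c ≢ a → c ≢ b → sw a b c ≡ c
sw-other {a} {b} {c} c≢a c≢b with c ≟ a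
... | yes c≡a = ⊥-elim (c≢a c≡a)
... | no _ with c ≟ b
...   | yes c≡b = ⊥-elim (c≢b c≡b)
...   | no _ = refl

sw-same : ∀ a c → sw a a c ≡ c
sw-same a c with c ≟ a
... | yes c≡a = sym c≡a
... | no c≢a with c ≟ a
...   | yes c≡a = ⊥-elim (c≢a c≡a)
...   | no _ = refl

fun-sw : ∀ τ p q c → fun τ (sw p q c) ≡ sw (fun τ p) (fun τ q) (fun τ c)
fun-sw τ p q c with c ≟ p
... | yes refl = sym (sw-first (fun τ c) (fun τ q))
... | no c≢p with c ≟ q
...   | yes refl = sym (sw-second (fun τ p) (fun τ c))
...   | no c≢q = sym (sw-other (c≢p ∘ fun-injective τ) (c≢q ∘ fun-injective τ))

-- Opaque: only the existence of a fresh atom matters, and matching on the freshness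
-- proof would otherwise unfold max over symbolic lists.
opaque
  fresh : (L : List Atom) → ∃ λ e → All (_≢ e) L
  fresh L = suc (max 0 L) , All.map (λ x≤max → <⇒≢ (s≤s x≤max)) (xs≤max 0 L)

module _ {S : Signature} where

  mutual
    atoms : Term S → List Atom
    atoms (atm a)    = a ∷ []
    atoms (mv π X)   = supp π
    atoms (lam a t)  = a ∷ atoms t
    atoms (app f ts) = atomss ts

    atomss : ∀ {n} → Vec (Term S) n → List Atom
    atomss V.[]       = []
    atomss (t V.∷ ts) = atoms t ++ atomss ts

  mutual
    occ⇒∈atoms : ∀ {c} {t : Term S} → c occ t → c ∈ atoms t
    occ⇒∈atoms occ-atm                   = here refl
    occ⇒∈atoms {c} {mv π X} (occ-mv c∈) = finite π c c∈
    occ⇒∈atoms occ-lam                   = here refl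
    occ⇒∈atoms (occ-in o)                = there (occ⇒∈atoms o)
    occ⇒∈atoms (occ-app o)               = occs⇒∈atomss o

    occs⇒∈atomss : ∀ {c n} {ts : Vec (Term S) n} → c occs ts → c ∈ atomss ts
    occs⇒∈atomss (occ-hd o)                = ∈-++⁺ˡ (occ⇒∈atoms o)
    occs⇒∈atomss {ts = t V.∷ _} (occ-tl o) = ∈-++⁺ʳ (atoms t) (occs⇒∈atomss o)

  FreshIn : Atom → Ctx → Term S → Set
  FreshIn c Υ t = ¬ c occΥ Υ × ¬ c occ t

  occ-≢ : ∀ {c c' Υ} {t : Term S} → FreshIn c' Υ t → c occ t → c ≢ c'
  occ-≢ c'# o refl = proj₂ c'# o

  occΥ-≢ : ∀ {c c' Υ} {t : Term S} → FreshIn c' Υ t → c occΥ Υ → c ≢ c'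
  occΥ-≢ c'# o refl = proj₁ c'# o

  lam-fresh : ∀ {c Υ π a} {t : Term S} →
    FreshFor c Υ (π ∷ []) (lam a t ∷ []) → FreshIn c Υ t × a ≢ c × ¬ c ∈dom π
  lam-fresh (c∉Υ , c∉π , c∉lam) =
    (c∉Υ , c∉lam (here refl) ∘ occ-in) , (λ { refl → c∉lam (here refl) occ-lam }) , c∉π (here refl)

  perm-fresh : ∀ {c Υ} {s t : Term S} → FreshFor c Υ [] (s ∷ t ∷ []) → FreshIn c Υ t × ¬ c occ s
  perm-fresh (c∉Υ , _ , c∉ts) = (c∉Υ , c∉ts (there (here refl))) , c∉ts (here refl)

ctxAtoms : Ctx → List Atom
ctxAtoms = concatMap (supp ∘ proj₁)

occΥ⇒∈ctxAtoms : ∀ {c Υ} → c occΥ Υ → c ∈ ctxAtoms Υ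
occΥ⇒∈ctxAtoms {c} (γ , _ , γX∈Υ , c∈domγ) = ∈-concatMap⁺ (supp ∘ proj₁) (lose γX∈Υ (finite γ c c∈domγ))

module NominalSetProperties {ℓ : Level} (N : NominalSet ℓ) where
  open NominalSet N

  support : Carrier → List Atom
  support x = proj₁ (supported x)

  act-square : ∀ {π ρ π' ρ'} → (∀ a → fun π (fun ρ a) ≡ fun π' (fun ρ' a)) →
               ∀ x → act π (act ρ x) ≡ act π' (act ρ' x)
  act-square {π} {ρ} {π'} {ρ'} h x = begin
    act π (act ρ x)    ≡⟨ act-∘ π ρ x ⟩
    act (π ∘P ρ) x     ≡⟨ act-ext (π ∘P ρ) (π' ∘P ρ') h x ⟩
    act (π' ∘P ρ') x   ≡⟨ act-∘ π' ρ' x ⟨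
    act π' (act ρ' x)  ∎

  act-inv-l : ∀ τ x → act (τ ⁻¹P) (act τ x) ≡ x
  act-inv-l τ x = trans (act-square (inv-l τ) x) (trans (act-id (act idP x)) (act-id x))

  act-injective : ∀ τ {x y} → act τ x ≡ act τ y → x ≡ y
  act-injective τ {x} {y} eq = begin
    x                         ≡⟨ act-inv-l τ x ⟨
    act (τ ⁻¹P) (act τ x)     ≡⟨ cong (act (τ ⁻¹P)) eq ⟩
    act (τ ⁻¹P) (act τ y)     ≡⟨ act-inv-l τ y ⟩
    y                         ∎

  act-comm : ∀ π τ → (∀ c → c ∈dom π → fun τ c ≡ c) → ∀ x → act π (act τ x) ≡ act τ (act π x)
  act-comm π τ τ-fixes = act-square (fun-comm π τ τ-fixes)

  act-sw-conj : ∀ τ {p q p' q'} → fun τ p ≡ p' → fun τ q ≡ q' →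
                ∀ x → act ⟨ p' ⇄ q' ⟩ (act τ x) ≡ act τ (act ⟨ p ⇄ q ⟩ x)
  act-sw-conj τ refl refl = act-square (λ c → sym (fun-sw τ _ _ c))

  sw-same-fixes : ∀ a x → act ⟨ a ⇄ a ⟩ x ≡ x
  sw-same-fixes a x = trans (act-ext ⟨ a ⇄ a ⟩ idP (sw-same a) x) (act-id x)

  sw-fixes-outside-support : ∀ {e₁ e₂} x → All (_≢ e₁) (support x) → All (_≢ e₂) (support x) →
                             act ⟨ e₁ ⇄ e₂ ⟩ x ≡ x
  sw-fixes-outside-support x e₁# e₂# =
    proj₂ (supported x) ⟨ _ ⇄ _ ⟩ (λ b b∈ → sw-other (All.lookup e₁# b∈) (All.lookup e₂# b∈))

  sw-fixed-via : ∀ {a b e} x → a ≢ b → a ≢ e →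
                 act ⟨ a ⇄ e ⟩ x ≡ x → act ⟨ b ⇄ e ⟩ x ≡ x → act ⟨ a ⇄ b ⟩ x ≡ x
  sw-fixed-via {a} {b} {e} x a≢b a≢e ae-fixes be-fixes = begin
    act ⟨ a ⇄ b ⟩ x                  ≡⟨ cong (act ⟨ a ⇄ b ⟩) (sym be-fixes) ⟩
    act ⟨ a ⇄ b ⟩ (act ⟨ b ⇄ e ⟩ x)  ≡⟨ act-sw-conj ⟨ b ⇄ e ⟩ (sw-other a≢b a≢e) (sw-second b e) x ⟩
    act ⟨ b ⇄ e ⟩ (act ⟨ a ⇄ e ⟩ x)  ≡⟨ cong (act ⟨ b ⇄ e ⟩) ae-fixes ⟩
    act ⟨ b ⇄ e ⟩ x                  ≡⟨ be-fixes ⟩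
    x                                ∎

  strong-fixed-if-covered : IsStrong → ∀ ρ x → (∀ a → a ∈dom ρ → ∃ λ γ → act γ x ≡ x × a ∈dom γ) →
                 act ρ x ≡ x
  strong-fixed-if-covered strong ρ x covered = Equivalence.to (proj₂ (strong x) ρ) ρ-fixes-support
    where
    ρ-fixes-support : ∀ a → a ∈ proj₁ (strong x) → fun ρ a ≡ a
    ρ-fixes-support a a∈B = decidable-stable (fun ρ a ≟ a) λ a∈domρ →
      let γ , γ-fixes , a∈domγ = covered a a∈domρ
      in a∈domγ (Equivalence.from (proj₂ (strong x) γ) γ-fixes a a∈B)

module StrongAlgebraProperties {ℓ : Level} {S : Signature} (A : StrongAlgebra ℓ S) where
  open StrongAlgebra A
  open NominalSetProperties nom

  ⟦_⟧ᴬ : Term S → Valuation A → Carrier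
  ⟦_⟧ᴬ = ⟦_⟧ A

  ⟦_⟧ᴬs : ∀ {n} → Vec (Term S) n → Valuation A → Vec Carrier n
  ⟦_⟧ᴬs = ⟦_⟧s A

  mutual
    ⟦⟧-equivariant : ∀ ρ s ς → ⟦ ρ · s ⟧ᴬ ς ≡ act ρ (⟦ s ⟧ᴬ ς)
    ⟦⟧-equivariant ρ (atm a) ς    = atom-eqv ρ a
    ⟦⟧-equivariant ρ (mv π X) ς   = sym (act-∘ ρ π (ς X))
    ⟦⟧-equivariant ρ (lam a s) ς  =
      trans (cong (absᴬ (fun ρ a)) (⟦⟧-equivariant ρ s ς)) (abs-eqv ρ a (⟦ s ⟧ᴬ ς))
    ⟦⟧-equivariant ρ (app f ts) ς =
      trans (cong (opᴬ f) (⟦⟧s-equivariant ρ ts ς)) (op-eqv ρ f (⟦ ts ⟧ᴬs ς))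

    ⟦⟧s-equivariant : ∀ {n} ρ (ts : Vec (Term S) n) ς →
                      ⟦ ρ ·s ts ⟧ᴬs ς ≡ V.map (act ρ) (⟦ ts ⟧ᴬs ς)
    ⟦⟧s-equivariant ρ V.[] ς       = refl
    ⟦⟧s-equivariant ρ (t V.∷ ts) ς = cong₂ V._∷_ (⟦⟧-equivariant ρ t ς) (⟦⟧s-equivariant ρ ts ς)

  mutual
    ⟦⟧-rename : ∀ τ s ς → (∀ c → c occ s → fun τ c ≡ c) → ⟦ s ⟧ᴬ (act τ ∘ ς) ≡ act τ (⟦ s ⟧ᴬ ς)
    ⟦⟧-rename τ (atm a) ς τ-fixes    = trans (cong atomᴬ (sym (τ-fixes a occ-atm))) (atom-eqv τ a)
    ⟦⟧-rename τ (mv π X) ς τ-fixes   = act-comm π τ (λ c c∈domπ → τ-fixes c (occ-mv c∈domπ)) (ς X)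
    ⟦⟧-rename τ (lam a s) ς τ-fixes  = begin
      absᴬ a (⟦ s ⟧ᴬ (act τ ∘ ς))        ≡⟨ cong (absᴬ a) (⟦⟧-rename τ s ς (λ c → τ-fixes c ∘ occ-in)) ⟩
      absᴬ a (act τ (⟦ s ⟧ᴬ ς))          ≡⟨ cong (λ b → absᴬ b (act τ (⟦ s ⟧ᴬ ς))) (τ-fixes a occ-lam) ⟨
      absᴬ (fun τ a) (act τ (⟦ s ⟧ᴬ ς))  ≡⟨ abs-eqv τ a (⟦ s ⟧ᴬ ς) ⟩
      act τ (absᴬ a (⟦ s ⟧ᴬ ς))          ∎
    ⟦⟧-rename τ (app f ts) ς τ-fixes =
      trans (cong (opᴬ f) (⟦⟧s-rename τ ts ς (λ c → τ-fixes c ∘ occ-app))) (op-eqv τ f (⟦ ts ⟧ᴬs ς))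

    ⟦⟧s-rename : ∀ {n} τ (ts : Vec (Term S) n) ς → (∀ c → c occs ts → fun τ c ≡ c) →
                 ⟦ ts ⟧ᴬs (act τ ∘ ς) ≡ V.map (act τ) (⟦ ts ⟧ᴬs ς)
    ⟦⟧s-rename τ V.[] ς τ-fixes       = refl
    ⟦⟧s-rename τ (t V.∷ ts) ς τ-fixes =
      cong₂ V._∷_ (⟦⟧-rename τ t ς (λ c → τ-fixes c ∘ occ-hd)) (⟦⟧s-rename τ ts ς (λ c → τ-fixes c ∘ occ-tl))

  mutual
    ⟦⟧-subst : ∀ s σ ς → ⟦ s [ σ ] ⟧ᴬ ς ≡ ⟦ s ⟧ᴬ (λ X → ⟦ lookupσ σ X ⟧ᴬ ς)
    ⟦⟧-subst (atm a) σ ς    = refl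
    ⟦⟧-subst (mv π X) σ ς   = ⟦⟧-equivariant π (lookupσ σ X) ς
    ⟦⟧-subst (lam a s) σ ς  = cong (absᴬ a) (⟦⟧-subst s σ ς)
    ⟦⟧-subst (app f ts) σ ς = cong (opᴬ f) (⟦⟧s-subst ts σ ς)

    ⟦⟧s-subst : ∀ {n} (ts : Vec (Term S) n) σ ς → ⟦ ts [ σ ]s ⟧ᴬs ς ≡ ⟦ ts ⟧ᴬs (λ X → ⟦ lookupσ σ X ⟧ᴬ ς)
    ⟦⟧s-subst V.[] σ ς       = refl
    ⟦⟧s-subst (t V.∷ ts) σ ς = cong₂ V._∷_ (⟦⟧-subst t σ ς) (⟦⟧s-subst ts σ ς)

  mutual
    ⟦⟧-resp-≋ : ∀ {t u} ς → t ≋ u → ⟦ t ⟧ᴬ ς ≡ ⟦ u ⟧ᴬ ς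
    ⟦⟧-resp-≋ ς ≋-atm                   = refl
    ⟦⟧-resp-≋ ς (≋-mv {π} {ρ} {X} π≗ρ) = act-ext π ρ π≗ρ (ς X)
    ⟦⟧-resp-≋ ς (≋-lam t≋u)             = cong (absᴬ _) (⟦⟧-resp-≋ ς t≋u)
    ⟦⟧-resp-≋ ς (≋-app ts≋us)           = cong (opᴬ _) (⟦⟧s-resp-≋ ς ts≋us)

    ⟦⟧s-resp-≋ : ∀ {n} {ts us : Vec (Term S) n} ς → ts ≋s us → ⟦ ts ⟧ᴬs ς ≡ ⟦ us ⟧ᴬs ς
    ⟦⟧s-resp-≋ ς ≋-[]              = refl
    ⟦⟧s-resp-≋ ς (≋-∷ t≋u ts≋us) = cong₂ V._∷_ (⟦⟧-resp-≋ ς t≋u) (⟦⟧s-resp-≋ ς ts≋us)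

  ⟦⟧s-update : ∀ {n} (ts : Vec (Term S) n) i {t u} ς → ⟦ t ⟧ᴬ ς ≡ ⟦ u ⟧ᴬ ς →
               ⟦ ts V.[ i ]≔ t ⟧ᴬs ς ≡ ⟦ ts V.[ i ]≔ u ⟧ᴬs ς
  ⟦⟧s-update (_ V.∷ ts) Fin.zero ς t≡u    = cong (V._∷ ⟦ ts ⟧ᴬs ς) t≡u
  ⟦⟧s-update (s V.∷ ts) (Fin.suc i) ς t≡u = cong (⟦ s ⟧ᴬ ς V.∷_) (⟦⟧s-update ts i ς t≡u)

  map-act-fixed : ∀ π {n} (ts : Vec (Term S) n) ς →
                  (∀ i → act π (⟦ V.lookup ts i ⟧ᴬ ς) ≡ ⟦ V.lookup ts i ⟧ᴬ ς) →
                  V.map (act π) (⟦ ts ⟧ᴬs ς) ≡ ⟦ ts ⟧ᴬs ς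
  map-act-fixed π V.[] ς fixed       = refl
  map-act-fixed π (t V.∷ ts) ς fixed = cong₂ V._∷_ (fixed Fin.zero) (map-act-fixed π ts ς (fixed ∘ Fin.suc))

  -- Neither s nor π · s mentions the moved atom a, so s contains no variable.
  module _ (π : Perm) (a : Atom) (πa≢a : fun π a ≢ a)
           (moves-only-a : ∀ c → c ≢ a → fun π c ≢ a → fun π c ≡ c) where
    mutual
      ⟦⟧-fixed-avoiding : ∀ s ς → ¬ a occ s → ¬ a occ (π · s) → act π (⟦ s ⟧ᴬ ς) ≡ ⟦ s ⟧ᴬ ς
      ⟦⟧-fixed-avoiding (atm c) ς a∉s a∉πs = begin
        act π (atomᴬ c)   ≡⟨ atom-eqv π c ⟨
        atomᴬ (fun π c)   ≡⟨ cong atomᴬ (moves-only-a c c≢a πc≢a) ⟩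
        atomᴬ c           ∎
        where
        c≢a : c ≢ a
        c≢a refl = a∉s occ-atm
        πc≢a : fun π c ≢ a
        πc≢a πc≡a = a∉πs (subst (λ b → a occ atm b) (sym πc≡a) occ-atm)
      ⟦⟧-fixed-avoiding (mv ρ X) ς a∉s a∉πs =
        ⊥-elim (a∉πs (occ-mv λ πρa≡a → a∉s (occ-mv λ ρa≡a →
          πa≢a (trans (cong (fun π) (sym ρa≡a)) πρa≡a))))
      ⟦⟧-fixed-avoiding (lam c s) ς a∉s a∉πs = begin
        act π (absᴬ c (⟦ s ⟧ᴬ ς))          ≡⟨ abs-eqv π c (⟦ s ⟧ᴬ ς) ⟨
        absᴬ (fun π c) (act π (⟦ s ⟧ᴬ ς))  ≡⟨ cong₂ absᴬ (moves-only-a c c≢a πc≢a)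
                                               (⟦⟧-fixed-avoiding s ς (a∉s ∘ occ-in) (a∉πs ∘ occ-in)) ⟩
        absᴬ c (⟦ s ⟧ᴬ ς)                  ∎
        where
        c≢a : c ≢ a
        c≢a refl = a∉s occ-lam
        πc≢a : fun π c ≢ a
        πc≢a πc≡a = a∉πs (subst (λ b → a occ lam b (π · s)) (sym πc≡a) occ-lam)
      ⟦⟧-fixed-avoiding (app f ts) ς a∉s a∉πs =
        trans (sym (op-eqv π f (⟦ ts ⟧ᴬs ς)))
              (cong (opᴬ f) (⟦⟧s-fixed-avoiding ts ς (a∉s ∘ occ-app) (a∉πs ∘ occ-app)))

      ⟦⟧s-fixed-avoiding : ∀ {n} (ts : Vec (Term S) n) ς → ¬ a occs ts → ¬ a occs (π ·s ts) →
                           V.map (act π) (⟦ ts ⟧ᴬs ς) ≡ ⟦ ts ⟧ᴬs ς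
      ⟦⟧s-fixed-avoiding V.[] ς a∉ts a∉πts       = refl
      ⟦⟧s-fixed-avoiding (t V.∷ ts) ς a∉ts a∉πts =
        cong₂ V._∷_ (⟦⟧-fixed-avoiding t ς (a∉ts ∘ occ-hd) (a∉πts ∘ occ-hd))
                    (⟦⟧s-fixed-avoiding ts ς (a∉ts ∘ occ-tl) (a∉πts ∘ occ-tl))

  sw-fixed-avoiding-first : ∀ {a b} s ς → a ≢ b → ¬ a occ s → ¬ a occ (⟨ a ⇄ b ⟩ · s) →
                            act ⟨ a ⇄ b ⟩ (⟦ s ⟧ᴬ ς) ≡ ⟦ s ⟧ᴬ ς
  sw-fixed-avoiding-first {a} {b} s ς a≢b =
    ⟦⟧-fixed-avoiding ⟨ a ⇄ b ⟩ a (λ ab·a≡a → a≢b (trans (sym ab·a≡a) (sw-first a b)))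
      (λ c c≢a ab·c≢a → sw-other c≢a λ { refl → ab·c≢a (sw-second a c) }) s ς

  sw-fixed-avoiding-second : ∀ {a b} s ς → a ≢ b → ¬ b occ s → ¬ b occ (⟨ a ⇄ b ⟩ · s) →
                             act ⟨ a ⇄ b ⟩ (⟦ s ⟧ᴬ ς) ≡ ⟦ s ⟧ᴬ ς
  sw-fixed-avoiding-second {a} {b} s ς a≢b =
    ⟦⟧-fixed-avoiding ⟨ a ⇄ b ⟩ b (λ ab·b≡b → a≢b (trans (sym (sw-second a b)) ab·b≡b))
      (λ c c≢b ab·c≢b → sw-other (λ { refl → ab·c≢b (sw-first c b) }) c≢b) s ς

  strongSupport : Carrier → List Atom
  strongSupport x = proj₁ (strong x)

  binder-∉-strongSupport : ∀ a x → ¬ a ∈ strongSupport (absᴬ a x)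
  binder-∉-strongSupport a x a∈B with fresh (a ∷ proj₁ (abs-fin a x))
  ... | k , a≢k ∷ k# = All.lookup k# (proj₂ (abs-fin a x) k moved) refl
    where
    moved : act ⟨ a ⇄ k ⟩ (absᴬ a x) ≢ absᴬ a x
    moved fixed =
      a≢k (trans (sym (Equivalence.from (proj₂ (strong (absᴬ a x)) ⟨ a ⇄ k ⟩) fixed a a∈B)) (sw-first a k))

  absᴬ-rename : ∀ {a e} x → All (_≢ e) (strongSupport (absᴬ a x)) → absᴬ e (act ⟨ a ⇄ e ⟩ x) ≡ absᴬ a x
  absᴬ-rename {a} {e} x e# = begin
    absᴬ e (act ⟨ a ⇄ e ⟩ x)           ≡⟨ cong (λ b → absᴬ b (act ⟨ a ⇄ e ⟩ x)) (sym (sw-first a e)) ⟩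
    absᴬ (sw a e a) (act ⟨ a ⇄ e ⟩ x)  ≡⟨ abs-eqv ⟨ a ⇄ e ⟩ a x ⟩
    act ⟨ a ⇄ e ⟩ (absᴬ a x)           ≡⟨ Equivalence.to (proj₂ (strong (absᴬ a x)) ⟨ a ⇄ e ⟩) sw-fixes-support ⟩
    absᴬ a x                           ∎
    where
    sw-fixes-support : ∀ b → b ∈ strongSupport (absᴬ a x) → sw a e b ≡ b
    sw-fixes-support b b∈B =
      sw-other (λ b≡a → binder-∉-strongSupport a x (subst (_∈ _) b≡a b∈B)) (All.lookup e# b∈B)

  ⊆domCtx-fixes : ∀ {Υ ς ρ X} → ρ ⊆domCtx Υ ∣ X → ValidCtx A Υ ς → act ρ (ς X) ≡ ς X
  ⊆domCtx-fixes {ρ = ρ} covered valid = strong-fixed-if-covered strong ρ _ λ a a∈domρ →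
    let γ , γX∈Υ , a∈domγ = covered a a∈domρ in γ , valid γX∈Υ , a∈domγ

  valid-++ : ∀ {Υ Υ' ς} → ValidCtx A Υ ς → ValidCtx A Υ' ς → ValidCtx A (Υ ++ Υ') ς
  valid-++ {Υ} valid valid' m with ∈-++⁻ Υ m
  ... | inj₁ m∈Υ  = valid m∈Υ
  ... | inj₂ m∈Υ' = valid' m∈Υ'

  footprint : Ctx → Term S → Valuation A → List Atom
  footprint Υ t ς = atoms t ++ ctxAtoms Υ ++ concatMap (support ∘ ς) (vars t)

  footprint-fresh : ∀ {Υ t ς e} → All (_≢ e) (footprint Υ t ς) → FreshIn e Υ t
  footprint-fresh {t = t} e# =
    (λ o → All.lookup e# (∈-++⁺ʳ (atoms t) (∈-++⁺ˡ (occΥ⇒∈ctxAtoms o))) refl) ,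
    (λ o → All.lookup e# (∈-++⁺ˡ (occ⇒∈atoms o)) refl)

  footprint-support : ∀ {Υ t ς e Y} → All (_≢ e) (footprint Υ t ς) → Y ∈ vars t → All (_≢ e) (support (ς Y))
  footprint-support {Υ} {t} {ς} e# Y∈t = All.tabulate λ b∈ →
    All.lookup e# (∈-++⁺ʳ (atoms t) (∈-++⁺ʳ (ctxAtoms Υ) (∈-concatMap⁺ (support ∘ ς) (lose Y∈t b∈))))

  module FreshRenaming {Υ : Ctx} {t : Term S} {ς : Valuation A} {c₁ c₂ e₁ e₂ : Atom}
    (c₁# : FreshIn c₁ Υ t) (c₂# : FreshIn c₂ Υ t) (c₁≢c₂ : c₁ ≢ c₂)
    (e₁# : All (_≢ e₁) (footprint Υ t ς)) (e₂# : All (_≢ e₂) (footprint Υ t ς))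
    (e₁≢e₂ : e₁ ≢ e₂) (c₂≢e₁ : c₂ ≢ e₁) where

    τ : Perm
    τ = ⟨ c₁ ⇄ e₁ ⟩ ∘P ⟨ c₂ ⇄ e₂ ⟩

    τ-e₁ : fun τ e₁ ≡ c₁
    τ-e₁ = trans (cong (sw c₁ e₁) (sw-other (≢-sym c₂≢e₁) e₁≢e₂)) (sw-second c₁ e₁)

    τ-e₂ : fun τ e₂ ≡ c₂
    τ-e₂ = trans (cong (sw c₁ e₁) (sw-second c₂ e₂)) (sw-other (≢-sym c₁≢c₂) c₂≢e₁)

    τ-fixes : ∀ {c} → c ≢ c₁ → c ≢ e₁ → c ≢ c₂ → c ≢ e₂ → fun τ c ≡ c
    τ-fixes c≢c₁ c≢e₁ c≢c₂ c≢e₂ = trans (cong (sw c₁ e₁) (sw-other c≢c₂ c≢e₂)) (sw-other c≢c₁ c≢e₁)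

    e₁-fresh : FreshIn e₁ Υ t
    e₁-fresh = footprint-fresh {Υ} {t} {ς} e₁#

    e₂-fresh : FreshIn e₂ Υ t
    e₂-fresh = footprint-fresh {Υ} {t} {ς} e₂#

    τ-fixes-t : ∀ c → c occ t → fun τ c ≡ c
    τ-fixes-t c o = τ-fixes (occ-≢ c₁# o) (occ-≢ e₁-fresh o) (occ-≢ c₂# o) (occ-≢ e₂-fresh o)

    τ-fixes-Υ : ∀ c → c occΥ Υ → fun τ c ≡ c
    τ-fixes-Υ c o = τ-fixes (occΥ-≢ c₁# o) (occΥ-≢ e₁-fresh o) (occΥ-≢ c₂# o) (occΥ-≢ e₂-fresh o)

    renamed-valid : ValidCtx A Υ ς → ValidCtx A (Υ ++ swCtx c₁ c₂ t) (act τ ∘ ς)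
    renamed-valid valid = valid-++ {Υ} valid-Υ valid-swCtx
      where
      valid-Υ : ValidCtx A Υ (act τ ∘ ς)
      valid-Υ {γ} {X} γX∈Υ = begin
        act γ (act τ (ς X))  ≡⟨ act-comm γ τ (λ c c∈domγ → τ-fixes-Υ c (γ , X , γX∈Υ , c∈domγ)) (ς X) ⟩
        act τ (act γ (ς X))  ≡⟨ cong (act τ) (valid γX∈Υ) ⟩
        act τ (ς X)          ∎
      -- (c₁ c₂) conjugated back along τ is (e₁ e₂), which fixes ς Y as e₁, e₂ avoid its support.
      valid-swCtx : ValidCtx A (swCtx c₁ c₂ t) (act τ ∘ ς)
      valid-swCtx m with ∈-map⁻ (λ Y → ⟨ c₁ ⇄ c₂ ⟩ , Y) m
      ... | Y , Y∈t , refl =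
        trans (act-sw-conj τ τ-e₁ τ-e₂ (ς Y))
              (cong (act τ) (sw-fixes-outside-support (ς Y) (footprint-support {Υ} {t} {ς} e₁# Y∈t)
                                                              (footprint-support {Υ} {t} {ς} e₂# Y∈t)))

    renamed-instance : (P : Carrier → Set ℓ) → ValidCtx A Υ ς →
                       (∀ ς' → ValidCtx A (Υ ++ swCtx c₁ c₂ t) ς' → P (⟦ t ⟧ᴬ ς')) →
                       P (act τ (⟦ t ⟧ᴬ ς))
    renamed-instance P valid premise =
      subst P (⟦⟧-rename τ t ς τ-fixes-t) (premise (act τ ∘ ς) (renamed-valid valid))

    sw-fixed : ∀ {p} → p ≢ c₁ → p ≢ e₁ → p ≢ c₂ → p ≢ e₂ → ValidCtx A Υ ς →
               (∀ ς' → ValidFresh A (Υ ++ swCtx c₁ c₂ t) ⟨ p ⇄ c₁ ⟩ t ς') →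
               act ⟨ p ⇄ e₁ ⟩ (⟦ t ⟧ᴬ ς) ≡ ⟦ t ⟧ᴬ ς
    sw-fixed {p} p≢c₁ p≢e₁ p≢c₂ p≢e₂ valid premise = act-injective τ (begin
      act τ (act ⟨ p ⇄ e₁ ⟩ x)  ≡⟨ sym (act-sw-conj τ (τ-fixes p≢c₁ p≢e₁ p≢c₂ p≢e₂) τ-e₁ x) ⟩
      act ⟨ p ⇄ c₁ ⟩ (act τ x)  ≡⟨ renamed-instance (λ y → act ⟨ p ⇄ c₁ ⟩ y ≡ y) valid premise ⟩
      act τ x                   ∎)
      where
      x : Carrier
      x = ⟦ t ⟧ᴬ ς

    fixes-sw : ∀ {π p} → (∀ c → c ∈dom π → fun τ c ≡ c) →
               p ≢ c₁ → p ≢ e₁ → p ≢ c₂ → p ≢ e₂ → ValidCtx A Υ ς →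
               (∀ ς' → ValidCtx A (Υ ++ swCtx c₁ c₂ t) ς' →
                  act π (act ⟨ p ⇄ c₁ ⟩ (⟦ t ⟧ᴬ ς')) ≡ act ⟨ p ⇄ c₁ ⟩ (⟦ t ⟧ᴬ ς')) →
               act π (act ⟨ p ⇄ e₁ ⟩ (⟦ t ⟧ᴬ ς)) ≡ act ⟨ p ⇄ e₁ ⟩ (⟦ t ⟧ᴬ ς)
    fixes-sw {π} {p} τ-fixes-domπ p≢c₁ p≢e₁ p≢c₂ p≢e₂ valid premise = act-injective τ (begin
      act τ (act π w)                   ≡⟨ act-comm π τ τ-fixes-domπ w ⟨
      act π (act τ w)                   ≡⟨ cong (act π) (sym τ-conj) ⟩
      act π (act ⟨ p ⇄ c₁ ⟩ (act τ x))  ≡⟨ renamed-instance (λ y → act π (act ⟨ p ⇄ c₁ ⟩ y) ≡ act ⟨ p ⇄ c₁ ⟩ y)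
                                                            valid premise ⟩
      act ⟨ p ⇄ c₁ ⟩ (act τ x)          ≡⟨ τ-conj ⟩
      act τ w                           ∎)
      where
      x : Carrier
      x = ⟦ t ⟧ᴬ ς
      w : Carrier
      w = act ⟨ p ⇄ e₁ ⟩ x
      τ-conj : act ⟨ p ⇄ c₁ ⟩ (act τ x) ≡ act τ w
      τ-conj = act-sw-conj τ (τ-fixes p≢c₁ p≢e₁ p≢c₂ p≢e₂) τ-e₁ x

  abs-fixed : ∀ {Υ π a t ς c₁ c₂} → c₁ ≢ c₂ →
    FreshIn c₁ Υ t × a ≢ c₁ × ¬ c₁ ∈dom π → FreshIn c₂ Υ t × a ≢ c₂ × ¬ c₂ ∈dom π →
    (∀ ς' → ValidFresh A (Υ ++ swCtx c₁ c₂ t) π (⟨ a ⇄ c₁ ⟩ · t) ς') →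
    ValidFresh A Υ π (lam a t) ς
  abs-fixed {Υ} {π} {a} {t} {ς} {c₁} {c₂} c₁≢c₂ (c₁# , a≢c₁ , c₁∉π) (c₂# , a≢c₂ , c₂∉π) premise valid
    with fresh (a ∷ c₂ ∷ strongSupport (absᴬ a (⟦ t ⟧ᴬ ς)) ++ supp π ++ footprint Υ t ς)
  ... | e₁ , a≢e₁ ∷ c₂≢e₁ ∷ e₁#
    with fresh (e₁ ∷ a ∷ supp π ++ footprint Υ t ς)
  ... | e₂ , e₁≢e₂ ∷ a≢e₂ ∷ e₂# = begin
    act π (absᴬ a x)           ≡⟨ cong (act π) (absᴬ-rename x e₁∉B) ⟨
    act π (absᴬ e₁ w)          ≡⟨ abs-eqv π e₁ w ⟨
    absᴬ (fun π e₁) (act π w)  ≡⟨ cong₂ absᴬ (supp-fresh-fixed π e₁∉π) π-fixes-w ⟩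
    absᴬ e₁ w                  ≡⟨ absᴬ-rename x e₁∉B ⟩
    absᴬ a x                   ∎
    where
    x : Carrier
    x = ⟦ t ⟧ᴬ ς
    w : Carrier
    w = act ⟨ a ⇄ e₁ ⟩ x
    B : List Atom
    B = strongSupport (absᴬ a x)
    e₁∉B : All (_≢ e₁) B
    e₁∉B = ++⁻ˡ B e₁#
    e₁∉π : All (_≢ e₁) (supp π)
    e₁∉π = ++⁻ˡ (supp π) (++⁻ʳ B e₁#)
    e₂∉π : All (_≢ e₂) (supp π)
    e₂∉π = ++⁻ˡ (supp π) e₂#
    open FreshRenaming c₁# c₂# c₁≢c₂ (++⁻ʳ (supp π) (++⁻ʳ B e₁#)) (++⁻ʳ (supp π) e₂#) e₁≢e₂ c₂≢e₁
    τ-fixes-domπ : ∀ c → c ∈dom π → fun τ c ≡ c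
    τ-fixes-domπ c c∈domπ = τ-fixes (λ { refl → c₁∉π c∈domπ }) (All.lookup e₁∉π (finite π c c∈domπ))
                                    (λ { refl → c₂∉π c∈domπ }) (All.lookup e₂∉π (finite π c c∈domπ))
    π-fixes-w : act π w ≡ w
    π-fixes-w = fixes-sw τ-fixes-domπ a≢c₁ a≢e₁ a≢c₂ a≢e₂ valid λ ς' valid' →
      subst (λ y → act π y ≡ y) (⟦⟧-equivariant ⟨ a ⇄ c₁ ⟩ t ς') (premise ς' valid')

  perm-fixed : ∀ {Υ a b t ς c₁ c₂ d₁ d₂} → c₁ ≢ c₂ → d₁ ≢ d₂ →
    FreshIn c₁ Υ t × ¬ c₁ occ (⟨ a ⇄ b ⟩ · t) → FreshIn c₂ Υ t × ¬ c₂ occ (⟨ a ⇄ b ⟩ · t) →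
    FreshIn d₁ Υ t × ¬ d₁ occ (⟨ a ⇄ b ⟩ · t) → FreshIn d₂ Υ t × ¬ d₂ occ (⟨ a ⇄ b ⟩ · t) →
    (∀ ς' → ValidFresh A (Υ ++ swCtx c₁ c₂ t) ⟨ a ⇄ c₁ ⟩ t ς') →
    (∀ ς' → ValidFresh A (Υ ++ swCtx d₁ d₂ t) ⟨ b ⇄ d₁ ⟩ t ς') →
    ValidFresh A Υ ⟨ a ⇄ b ⟩ t ς
  perm-fixed {Υ} {a} {b} {t} {ς} {c₁} {c₂} {d₁} {d₂} c₁≢c₂ d₁≢d₂ F₁ F₂ F₃ F₄ premise-a premise-b valid
    with a ≟ b | a ≟ c₁ | a ≟ c₂ | b ≟ d₁ | b ≟ d₂
  ... | yes refl | _ | _ | _ | _ = sw-same-fixes a (⟦ t ⟧ᴬ ς)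
  -- When a fresh atom coincides with a or b, that atom occurs in neither t nor (a b)·t.
  ... | no a≢b | yes refl | _ | _ | _ = sw-fixed-avoiding-first t ς a≢b (proj₂ (proj₁ F₁)) (proj₂ F₁)
  ... | no a≢b | _ | yes refl | _ | _ = sw-fixed-avoiding-first t ς a≢b (proj₂ (proj₁ F₂)) (proj₂ F₂)
  ... | no a≢b | _ | _ | yes refl | _ = sw-fixed-avoiding-second t ς a≢b (proj₂ (proj₁ F₃)) (proj₂ F₃)
  ... | no a≢b | _ | _ | _ | yes refl = sw-fixed-avoiding-second t ς a≢b (proj₂ (proj₁ F₄)) (proj₂ F₄)
  ... | no a≢b | no a≢c₁ | no a≢c₂ | no b≢d₁ | no b≢d₂
    with fresh (a ∷ b ∷ c₂ ∷ d₂ ∷ footprint Υ t ς)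
  ... | e₁ , a≢e₁ ∷ b≢e₁ ∷ c₂≢e₁ ∷ d₂≢e₁ ∷ e₁#
    with fresh (e₁ ∷ a ∷ b ∷ footprint Υ t ς)
  ... | e₂ , e₁≢e₂ ∷ a≢e₂ ∷ b≢e₂ ∷ e₂# = sw-fixed-via (⟦ t ⟧ᴬ ς) a≢b a≢e₁ ae₁-fixes be₁-fixes
    where
    ae₁-fixes : act ⟨ a ⇄ e₁ ⟩ (⟦ t ⟧ᴬ ς) ≡ ⟦ t ⟧ᴬ ς
    ae₁-fixes = FreshRenaming.sw-fixed (proj₁ F₁) (proj₁ F₂) c₁≢c₂ e₁# e₂# e₁≢e₂ c₂≢e₁
                                       a≢c₁ a≢e₁ a≢c₂ a≢e₂ valid premise-a
    be₁-fixes : act ⟨ b ⇄ e₁ ⟩ (⟦ t ⟧ᴬ ς) ≡ ⟦ t ⟧ᴬ ς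
    be₁-fixes = FreshRenaming.sw-fixed (proj₁ F₃) (proj₁ F₄) d₁≢d₂ e₁# e₂# e₁≢e₂ d₂≢e₁
                                       b≢d₁ b≢e₁ b≢d₂ b≢e₂ valid premise-b

  ⊢⅄-sound : ∀ {Υ π t} → Υ ⊢ π ⅄ t → ∀ ς → ValidFresh A Υ π t ς
  ⊢⅄-sound (⅄a {π} {a} πa≡a) ς valid = trans (sym (atom-eqv π a)) (cong atomᴬ πa≡a)
  ⊢⅄-sound (⅄f {π} {f} {ts} premises) ς valid =
    trans (sym (op-eqv π f (⟦ ts ⟧ᴬs ς)))
          (cong (opᴬ f) (map-act-fixed π ts ς λ i → ⊢⅄-sound (premises i) ς valid))
  ⊢⅄-sound (⅄var {π} {π'} {X} covered) ς valid = begin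
    act π (act π' (ς X))               ≡⟨ act-square (λ c → sym (inv-r π' (fun π (fun π' c)))) (ς X) ⟩
    act π' (act (π ^ (π' ⁻¹P)) (ς X))  ≡⟨ cong (act π') (⊆domCtx-fixes covered valid) ⟩
    act π' (ς X)                       ∎
  ⊢⅄-sound (⅄abs c₁ c₂ c₁≢c₂ F₁ F₂ premise) ς =
    abs-fixed c₁≢c₂ (lam-fresh F₁) (lam-fresh F₂) (⊢⅄-sound premise)

  ax-context-valid : ∀ {Υ Υ'} π σ ς → ValidCtx A Υ ς →
    (∀ {π' X} → (π' , X) ∈ Υ' → Υ ⊢ (π' ^ π) ⅄ (π · (‵ X [ σ ]))) →
    ValidCtx A Υ' (λ X → ⟦ lookupσ σ X ⟧ᴬ ς)
  ax-context-valid π σ ς valid premises {π'} {X} π'X∈Υ' = act-injective π (begin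
    act π (act π' y)                       ≡⟨ act-square (λ c → cong (fun π ∘ fun π') (inv-l π c)) y ⟨
    act (π' ^ π) (act π y)                 ≡⟨ cong (act (π' ^ π)) ⟦πX[σ]⟧ ⟨
    act (π' ^ π) (⟦ π · (‵ X [ σ ]) ⟧ᴬ ς)  ≡⟨ ⊢⅄-sound (premises π'X∈Υ') ς valid ⟩
    ⟦ π · (‵ X [ σ ]) ⟧ᴬ ς                 ≡⟨ ⟦πX[σ]⟧ ⟩
    act π y                                ∎)
    where
    y : Carrier
    y = ⟦ lookupσ σ X ⟧ᴬ ς
    ⟦πX[σ]⟧ : ⟦ π · (‵ X [ σ ]) ⟧ᴬ ς ≡ act π y
    ⟦πX[σ]⟧ = trans (⟦⟧-equivariant π (‵ X [ σ ]) ς)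
                    (cong (act π) (trans (⟦⟧-equivariant idP (lookupσ σ X) ς) (act-id y)))

module _ {ℓ : Level} {T : Theory} (M : StrongModel ℓ T) where
  open StrongAlgebra (alg M)
  open StrongAlgebraProperties (alg M)

  ⊢≐-sound : ∀ {Υ t u} → Υ ⊢[ T ] t ≐ u → ∀ ς → ValidEq (alg M) Υ t u ς
  ⊢≐-sound (refl≐ t≋u) ς valid = ⟦⟧-resp-≋ ς t≋u
  ⊢≐-sound (symm d) ς valid = sym (⊢≐-sound d ς valid)
  ⊢≐-sound (tran d d') ς valid = trans (⊢≐-sound d ς valid) (⊢≐-sound d' ς valid)
  ⊢≐-sound (ax {t = t} {u} axiom π σ premises) ς valid = begin
    ⟦ π · (t [ σ ]) ⟧ᴬ ς    ≡⟨ ⟦⟧-equivariant π (t [ σ ]) ς ⟩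
    act π (⟦ t [ σ ] ⟧ᴬ ς)  ≡⟨ cong (act π) (⟦⟧-subst t σ ς) ⟩
    act π (⟦ t ⟧ᴬ ςσ)       ≡⟨ cong (act π) (sound M axiom ςσ (ax-context-valid π σ ς valid premises)) ⟩
    act π (⟦ u ⟧ᴬ ςσ)       ≡⟨ cong (act π) (⟦⟧-subst u σ ς) ⟨
    act π (⟦ u [ σ ] ⟧ᴬ ς)  ≡⟨ ⟦⟧-equivariant π (u [ σ ]) ς ⟨
    ⟦ π · (u [ σ ]) ⟧ᴬ ς    ∎
    where
    ςσ : Valuation (alg M)
    ςσ X = ⟦ lookupσ σ X ⟧ᴬ ς
  ⊢≐-sound (cong[] {a} d) ς valid = cong (absᴬ a) (⊢≐-sound d ς valid)
  ⊢≐-sound (congf {f} ts i d) ς valid = cong (opᴬ f) (⟦⟧s-update ts i ς (⊢≐-sound d ς valid))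
  ⊢≐-sound (fr covered d) ς valid = ⊢≐-sound d ς λ where
    (here refl) → ⊆domCtx-fixes covered valid
    (there m)   → valid m
  ⊢≐-sound (perm {a} {b} {t} c₁ c₂ d₁ d₂ c₁≢c₂ _ _ _ _ d₁≢d₂ F₁ F₂ F₃ F₄ D₁ D₂) ς valid =
    trans (⟦⟧-equivariant ⟨ a ⇄ b ⟩ t ς)
          (perm-fixed c₁≢c₂ d₁≢d₂ (perm-fresh F₁) (perm-fresh F₂) (perm-fresh F₃) (perm-fresh F₄)
                      (⊢⅄-sound D₁) (⊢⅄-sound D₂) valid)

theorem4p1 : ∀ {ℓ : Level} (T : Theory) →
    (∀ {Υ : Ctx} {π : Perm} {t : Term (sig T)} →
      Υ ⊢ π ⅄ t → Υ ⊨ˢ[ T , ℓ ] π ⅄ t)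
    × (∀ {Υ : Ctx} {t u : Term (sig T)} →
      Υ ⊢[ T ] t ≐ u → Υ ⊨ˢ[ T , ℓ ] t ≐ u)
theorem4p1 T = (λ d M → StrongAlgebraProperties.⊢⅄-sound (alg M) d) , (λ d M → ⊢≐-sound M d)
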